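{- The Tutte polynomial of the broken wheel graph $BW_n$ satisfies $T_{BW_n}(1,0)=T_{BW_n}(0,1)=2^{n-1}$.
   Context: The broken wheel graph $BW_n$ is the multigraph on vertices $0,\dots,n$ with two parallel edges between $0$ and $1$, one edge $0$–$i$ for each $2\le i\le n$, and one edge $i$–$(i+1)$ for $1\le i\le n-1$. $T_{BW_n}$ is its Tutte polynomial. -}

module Defs where

open import Data.Bool using (Bool; true; false; _∧_; _∨_; not)
open import Data.Nat using (ℕ; zero; suc; _∸_; _+_)
open import Data.Nat.Properties using (_≟_)
open import Data.Integer using (ℤ; +_; _-_; _*_; _^_) renaming (_+_ to _+ℤ_)
open import Data.List using (List; []; _∷_; _++_; map; length; upTo; filterᵇ; foldr; applyUpTo)
open import Data.Bool.ListAction using (any)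
open import Data.Product using (_×_; _,_; proj₁; proj₂)
open import Relation.Nullary.Decidable using (⌊_⌋)

-- A finite multigraph: vertices 0 … V-1, edges a list of (unordered)
-- endpoint pairs; parallel edges are repeated list entries.
record Graph : Set where
  constructor graph
  field
    V : ℕ
    E : List (ℕ × ℕ)
open Graph public

-- All sub-multisets of edges (subsets of the edge list, by position).
subsets : {X : Set} → List X → List (List X)
subsets []       = [] ∷ []
subsets (x ∷ xs) = map (x ∷_) (subsets xs) ++ subsets xs

reach : List (ℕ × ℕ) → ℕ → ℕ → ℕ → Bool
reach A zero    i j = ⌊ i ≟ j ⌋
reach A (suc k) i j =
  reach A k i j ∨
  any (λ e → (reach A k i (proj₁ e) ∧ ⌊ proj₂ e ≟ j ⌋)
           ∨ (reach A k i (proj₂ e) ∧ ⌊ proj₁ e ≟ j ⌋)) A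

-- connected in the spanning subgraph (V, A)  (walks of length ≤ V suffice)
connected : ℕ → List (ℕ × ℕ) → ℕ → ℕ → Bool
connected V A i j = reach A V i j

-- number of connected components of the spanning subgraph (V, A):
-- number of vertices that are the least vertex of their component
components : ℕ → List (ℕ × ℕ) → ℕ
components V A =
  length (filterᵇ (λ i → not (any (λ j → connected V A j i) (upTo i))) (upTo V))

rank : ℕ → List (ℕ × ℕ) → ℕ
rank V A = V ∸ components V A

sumℤ : List ℤ → ℤ
sumℤ = foldr _+ℤ_ (+ 0)

-- Tutte polynomial (rank–generating function), evaluated at integers x, y:
-- T_G(x,y) = Σ_{A ⊆ E} (x-1)^{r(E)-r(A)} (y-1)^{|A|-r(A)}   (with 0^0 = 1)
tutte : Graph → ℤ → ℤ → ℤ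
tutte G x y =
  sumℤ (map (λ A → ((x - + 1) ^ (rank (V G) (E G) ∸ rank (V G) A))
                 * ((y - + 1) ^ (length A ∸ rank (V G) A)))
            (subsets (E G)))

-- Broken wheel BW_n: vertices 0..n, two parallel edges 0–1,
-- edges 0–i for 2 ≤ i ≤ n, edges i–(i+1) for 1 ≤ i ≤ n-1.
brokenWheel : ℕ → Graph
brokenWheel n = graph (suc n)
  ((0 , 1) ∷ (0 , 1) ∷
   (applyUpTo (λ k → (0 , k + 2)) (n ∸ 1) ++
    applyUpTo (λ k → (k + 1 , k + 2)) (n ∸ 1)))

-- BW_(k+2) arises from BW_(k+1) by adding the vertex k+2 with the spoke (0, k+2) and the
-- rim edge (k+1, k+2). Sort the subsets A of its edges by which of these two edges they
-- contain: with neither, k+2 is an isolated vertex of A (the summand gains a factor x − 1);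
-- with one, it is a pendant vertex (no change); with both, it subdivides a second copy of the
-- spoke (0, k+1), and doubling an edge already in A multiplies the summand by y − 1. So if
-- T_k is the Tutte polynomial of BW_(k+1), P_k the part of its subset expansion over subsets
-- containing (0, k+1) and Q_k = T_k − P_k, then
--   P_(k+1) = y P_k + T_k,    Q_(k+1) = x T_k.
-- At (1, 0) this gives T_(k+1) = 2 T_k directly; at (0, 1) it gives Q_k = 0 and then again
-- T_(k+1) = 2 T_k. Finally T_0 = x + y = 1 at both points.
module Submission where

open import Defs
open import Data.Bool using (Bool; true; false; T; not)
open import Data.Bool.Properties using (T-∨; T-∧)
open import Data.Bool.ListAction using (any; or)
open import Data.Empty using (⊥-elim)
open import Data.Integer as ℤ using (ℤ; +_; 0ℤ; 1ℤ; _-_)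
  renaming (_+_ to _+ℤ_; _*_ to _*ℤ_; _^_ to _^ℤ_)
import Data.Integer.Properties as ℤ
open import Data.Integer.Tactic.RingSolver using (solve-∀)
open import Algebra.Properties.CommutativeSemigroup ℤ.*-commutativeSemigroup using (x∙yz≈y∙xz)
open import Algebra.Properties.CommutativeSemigroup ℤ.+-commutativeSemigroup using (interchange)
open import Data.List using (List; []; _∷_; [_]; _++_; map; length; filterᵇ; upTo; applyUpTo)
open import Data.List.Membership.Propositional using (_∈_; find; lose)
open import Data.List.Membership.Propositional.Properties using (∈-upTo⁺; ∈-upTo⁻; ∈-map⁺; ∈-map⁻)
open import Data.List.Properties
  using (++-assoc; applyUpTo-∷ʳ; map-++; map-∘; map-cong; map-cong-local; map-id-local;
         length-filter; length-upTo; length-++; filter-++; upTo-∷ʳ)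
open import Data.List.Relation.Binary.Permutation.Propositional as ↭ using (_↭_)
open import Data.List.Relation.Binary.Permutation.Propositional.Properties
  using (∈-resp-↭; ↭-length; shift; shifts; ∷↭∷ʳ; ++⁺ˡ)
open import Data.List.Relation.Binary.Sublist.Propositional using (_⊆_; []; _∷_; _∷ʳ_)
open import Data.List.Relation.Binary.Sublist.Propositional.Properties using (All-resp-⊆)
open import Data.List.Relation.Unary.All as All using (All; []; _∷_)
import Data.List.Relation.Unary.All.Properties as All
open import Data.List.Relation.Unary.Any using (Any; here; there; any?)
open import Data.List.Relation.Unary.Any.Properties using (any⁺; any⁻)
open import Data.Nat
  using (ℕ; zero; suc; _+_; _∸_; _^_; _≤_; _≥_; _<_; _≤′_; ≤′-refl; ≤′-step; z≤n; s≤s)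
open import Data.Nat.Properties
  using (_≟_; ≤-refl; ≤-trans; ≤-reflexive; <-≤-trans; <-irrefl; <-trans; ≤∧≢⇒<; ≤⇒≤′;
         m≤n⇒m≤1+n; n≤1+n; m<n⇒m<1+n; n<1+n; +-comm; +-identityʳ; +-suc;
         +-∸-assoc; ∸-+-assoc; m∸[m∸n]≡n; m+n∸n≡m; m+[n∸m]≡n)
open import Data.Product as Product using (_×_; _,_; proj₁; proj₂; ∃-syntax)
open import Data.Sum as Sum using (_⊎_; inj₁; inj₂)
open import Function using (_∘_; id; _⇔_; mk⇔; Equivalence)
open import Relation.Binary.Construct.Closure.ReflexiveTransitive
  using (Star; ε; _◅_; _◅◅_; return; kleisliStar; _⋆; reverse)
open import Relation.Binary.PropositionalEquality
  using (module ≡-Reasoning; _≡_; refl; sym; trans; subst; subst₂; cong; cong₂)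
open import Relation.Nullary using (¬_; yes; no; _×-dec_; ¬?)
open import Relation.Nullary.Decidable using (toWitness; fromWitness; decidable-stable; T?)

open Equivalence using (to; from)

Edge : Set
Edge = ℕ × ℕ

Within : ℕ → List Edge → Set
Within V = All (λ e → proj₁ e < V × proj₂ e < V)

within-suc : ∀ {V A} → Within V A → Within (suc V) A
within-suc = All.map (Product.map m<n⇒m<1+n m<n⇒m<1+n)

Adjacent : List Edge → ℕ → ℕ → Set
Adjacent A u v = (u , v) ∈ A ⊎ (v , u) ∈ A

adjacent-⊆ : ∀ {A B a b} → (∀ {e} → e ∈ A → e ∈ B) → Adjacent A a b → Adjacent B a b
adjacent-⊆ A⊆B = Sum.map A⊆B A⊆B

adjacent-flip : ∀ {u v A a b} → Adjacent ((v , u) ∷ A) a b → Adjacent ((u , v) ∷ A) a b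
adjacent-flip (inj₁ (here refl))  = inj₂ (here refl)
adjacent-flip (inj₂ (here refl))  = inj₁ (here refl)
adjacent-flip (inj₁ (there e∈A)) = inj₁ (there e∈A)
adjacent-flip (inj₂ (there e∈A)) = inj₂ (there e∈A)

Walk : List Edge → ℕ → ℕ → Set
Walk A = Star (Adjacent A)

walk-end : ∀ {V A i j} → Within V A → Walk A i j → i ≡ j ⊎ j < V
walk-end within ε = inj₁ refl
walk-end within (adj ◅ w) with walk-end within w
... | inj₂ j<V = inj₂ j<V
... | inj₁ refl with adj
...   | inj₁ e∈A = inj₂ (proj₂ (All.lookup within e∈A))
...   | inj₂ e∈A = inj₂ (proj₁ (All.lookup within e∈A))

-- Counting

count : {X : Set} → (X → Bool) → List X → ℕ
count p xs = length (filterᵇ p xs)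

module _ {X : Set} {p q : X → Bool} (p⇒q : ∀ {x} → T (p x) → T (q x)) where

  count-mono : ∀ xs → count p xs ≤ count q xs
  count-mono [] = z≤n
  count-mono (x ∷ xs) with p x in px | q x in qx
  ... | true  | true  = s≤s (count-mono xs)
  ... | false | true  = m≤n⇒m≤1+n (count-mono xs)
  ... | false | false = count-mono xs
  ... | true  | false = ⊥-elim (subst T qx (p⇒q (subst T (sym px) _)))

  count-mono-< : ∀ {xs} → Any (λ x → T (q x) × ¬ T (p x)) xs → count p xs < count q xs
  count-mono-< {x ∷ xs} (here (qx , ¬px)) with p x | q x
  ... | false | true  = s≤s (count-mono xs)
  ... | true  | _     = ⊥-elim (¬px _)
  count-mono-< {x ∷ xs} (there new) with p x in px | q x in qx
  ... | true  | true  = s≤s (count-mono-< new)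
  ... | false | true  = m≤n⇒m≤1+n (count-mono-< new)
  ... | false | false = count-mono-< new
  ... | true  | false = ⊥-elim (subst T qx (p⇒q (subst T (sym px) _)))

count≤length : {X : Set} (p : X → Bool) (xs : List X) → count p xs ≤ length xs
count≤length p = length-filter (T? ∘ p)

count-++ : {X : Set} (p : X → Bool) (xs ys : List X) → count p (xs ++ ys) ≡ count p xs + count p ys
count-++ p xs ys = trans (cong length (filter-++ (T? ∘ p) xs ys)) (length-++ (filterᵇ p xs))

count-cong : {X : Set} {p q : X → Bool} (xs : List X) → (∀ {x} → x ∈ xs → p x ≡ q x) →
             count p xs ≡ count q xs
count-cong [] _ = refl
count-cong {p = p} {q} (x ∷ xs) p≡q with p x | q x | p≡q (here refl)
... | true  | true  | _ = cong suc (count-cong xs (p≡q ∘ there))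
... | false | false | _ = count-cong xs (p≡q ∘ there)

T-injective : ∀ {a b} → (T a → T b) → (T b → T a) → a ≡ b
T-injective {false} {false} _ _ = refl
T-injective {false} {true} _ b⇒a = ⊥-elim (b⇒a _)
T-injective {true} {false} a⇒b _ = ⊥-elim (a⇒b _)
T-injective {true} {true} _ _ = refl

-- Reachability

module Reach (A : List Edge) where

  reach-zero : ∀ i j → T (reach A 0 i j) ⇔ i ≡ j
  reach-zero i j = mk⇔ (toWitness {a? = i ≟ j}) fromWitness

  reach-suc : ∀ k i j →
    T (reach A (suc k) i j) ⇔ (T (reach A k i j) ⊎ ∃[ u ] T (reach A k i u) × Adjacent A u j)
  reach-suc k i j = mk⇔ forward backward
    where
    Extends : Set
    Extends = T (reach A k i j) ⊎ ∃[ u ] T (reach A k i u) × Adjacent A u j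
    forward : T (reach A (suc k) i j) → Extends
    forward t with to T-∨ t
    ... | inj₁ r = inj₁ r
    ... | inj₂ a with find (any⁻ _ A a)
    ... | (u , v) , e∈A , last with to T-∨ last
    ...   | inj₁ t₁ with r , d ← to T-∧ t₁ with refl ← toWitness {a? = v ≟ j} d =
      inj₂ (u , r , inj₁ e∈A)
    ...   | inj₂ t₂ with r , d ← to T-∧ t₂ with refl ← toWitness {a? = u ≟ j} d =
      inj₂ (v , r , inj₂ e∈A)
    backward : Extends → T (reach A (suc k) i j)
    backward (inj₁ r) = from T-∨ (inj₁ r)
    backward (inj₂ (u , r , inj₁ e∈A)) = from T-∨ (inj₂ (any⁺ _ (lose e∈A
      (from T-∨ (inj₁ (from T-∧ (r , fromWitness refl)))))))
    backward (inj₂ (u , r , inj₂ e∈A)) = from T-∨ (inj₂ (any⁺ _ (lose e∈A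
      (from T-∨ (inj₂ (from T-∧ (r , fromWitness refl)))))))

  reach⇒walk : ∀ k i j → T (reach A k i j) → Walk A i j
  reach⇒walk zero i j r with refl ← to (reach-zero i j) r = ε
  reach⇒walk (suc k) i j r with to (reach-suc k i j) r
  ... | inj₁ r′ = reach⇒walk k i j r′
  ... | inj₂ (u , r′ , adj) = reach⇒walk k i u r′ ◅◅ return adj

  reach-extend : ∀ k i {u j} → T (reach A k i u) → Walk A u j → ∃[ m ] T (reach A m i j)
  reach-extend k i r ε = k , r
  reach-extend k i r (adj ◅ w) =
    reach-extend (suc k) i (from (reach-suc k i _) (inj₂ (_ , r , adj))) w

  walk⇒reach : ∀ {i j} → Walk A i j → ∃[ k ] T (reach A k i j)
  walk⇒reach {i} = reach-extend 0 i (from (reach-zero i i) refl)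

  reach-mono : ∀ {k} m i j → k ≤′ m → T (reach A k i j) → T (reach A m i j)
  reach-mono m i j ≤′-refl r = r
  reach-mono (suc n) i j (≤′-step k≤n) r =
    from (reach-suc n i j) (inj₁ (reach-mono n i j k≤n r))

reach-cong : ∀ {A B} → (∀ {a b} → Adjacent A a b → Adjacent B a b) →
  ∀ k i j → T (reach A k i j) → T (reach B k i j)
reach-cong A⇒B zero i j r = r
reach-cong {A} {B} A⇒B (suc k) i j r with to (Reach.reach-suc A k i j) r
... | inj₁ r′ = from (Reach.reach-suc B k i j) (inj₁ (reach-cong A⇒B k i j r′))
... | inj₂ (u , r′ , adj) =
  from (Reach.reach-suc B k i j) (inj₂ (u , reach-cong A⇒B k i u r′ , A⇒B adj))

-- The vertices reached from i within k steps lie below V and grow with k; once they stop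
-- growing they stay fixed, and they can grow at most V − 1 times.
module Saturation {V A i} (within : Within V A) (i<V : i < V) where

  open Reach A

  R : ℕ → ℕ → Bool
  R k = reach A k i

  Saturated : ℕ → Set
  Saturated k = ∀ j → T (R (suc k) j) → T (R k j)

  saturated-bound : ∀ k → Saturated k → ∀ m j → T (R m j) → T (R k j)
  saturated-bound k sat zero j r = reach-mono k i j (≤⇒≤′ z≤n) r
  saturated-bound k sat (suc m) j r with to (reach-suc m i j) r
  ... | inj₁ r′ = saturated-bound k sat m j r′
  ... | inj₂ (u , r′ , adj) =
    sat j (from (reach-suc k i j) (inj₂ (u , saturated-bound k sat m u r′ , adj)))

  reached<V : ∀ k j → T (R k j) → j < V
  reached<V k j r with walk-end within (reach⇒walk k i j r)
  ... | inj₁ refl = i<V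
  ... | inj₂ j<V = j<V

  reached : ℕ → ℕ
  reached k = count (R k) (upTo V)

  saturated-or-growing : ∀ k → Saturated k ⊎ reached k < reached (suc k)
  saturated-or-growing k with any? (λ j → T? (R (suc k) j) ×-dec ¬? (T? (R k j))) (upTo V)
  ... | yes new = inj₂ (count-mono-< (λ {j} → from (reach-suc k i j) ∘ inj₁) new)
  ... | no none = inj₁ λ j r →
    decidable-stable (T? (R k j)) λ ¬r →
      none (lose (∈-upTo⁺ (reached<V (suc k) j r)) (r , ¬r))

  saturated-by : ∀ k → (∃[ s ] s ≤ k × Saturated s) ⊎ k < reached k
  saturated-by zero = inj₂ (≤-trans (s≤s z≤n) (count-mono-< {p = λ _ → false} (λ ())
    (lose (∈-upTo⁺ i<V) (from (reach-zero i i) refl , λ ()))))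
  saturated-by (suc k) with saturated-by k
  ... | inj₁ (s , s≤k , sat) = inj₁ (s , m≤n⇒m≤1+n s≤k , sat)
  ... | inj₂ k<reached with saturated-or-growing k
  ...   | inj₁ sat = inj₁ (k , n≤1+n k , sat)
  ...   | inj₂ growing = inj₂ (≤-trans (s≤s k<reached) growing)

  reach-saturates : ∀ k j → T (R k j) → T (R V j)
  reach-saturates k j r with saturated-by V
  ... | inj₁ (s , s≤V , sat) = reach-mono V i j (≤⇒≤′ s≤V) (saturated-bound s sat k j r)
  ... | inj₂ V<reached = ⊥-elim (<-irrefl refl (<-≤-trans V<reached
    (≤-trans (count≤length (R V) (upTo V)) (≤-reflexive (length-upTo V)))))

connected⇔walk : ∀ {V A i j} → Within V A → i < V → T (connected V A i j) ⇔ Walk A i j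
connected⇔walk {V} {A} {i} {j} within i<V = mk⇔ (Reach.reach⇒walk A V i j) λ w →
  let k , r = Reach.walk⇒reach A w in Saturation.reach-saturates within i<V k j r

-- Components

-- components V A counts the vertices that are least in their component: it is
-- definitionally count (isLeader V A) (upTo V).
isLeader : ℕ → List Edge → ℕ → Bool
isLeader V A i = not (any (λ j → connected V A j i) (upTo i))

isLeader-cong : ∀ {W W′ X Y i} → Within W X → Within W′ Y → i < W → i < W′ →
  (∀ {j} → j < i → Walk X j i ⇔ Walk Y j i) → isLeader W X i ≡ isLeader W′ Y i
isLeader-cong wX wY i<W i<W′ same = cong (not ∘ or) (map-cong-local (All.tabulate λ j∈ →
  let j<i = ∈-upTo⁻ j∈
      X-walk = connected⇔walk wX (<-trans j<i i<W)
      Y-walk = connected⇔walk wY (<-trans j<i i<W′)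
  in T-injective (from Y-walk ∘ to (same j<i) ∘ to X-walk) (from X-walk ∘ from (same j<i) ∘ to Y-walk)))

components≤ : ∀ V A → components V A ≤ V
components≤ V A = ≤-trans (count≤length (isLeader V A) (upTo V)) (≤-reflexive (length-upTo V))

-- Vertex 0 is always a leader.
components-pos : ∀ V A → 1 ≤ components (suc V) A
components-pos V A = s≤s z≤n

components-cong : ∀ V {A B} → (∀ {a b} → Adjacent A a b → Adjacent B a b) →
  (∀ {a b} → Adjacent B a b → Adjacent A a b) → components V A ≡ components V B
components-cong V A⇒B B⇒A = count-cong (upTo V) λ {i} _ → cong (not ∘ or)
  (map-cong (λ j → T-injective (reach-cong A⇒B V j i) (reach-cong B⇒A V j i)) (upTo i))

components-dedup : ∀ V e A → components V (e ∷ e ∷ A) ≡ components V (e ∷ A)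
components-dedup V e A = components-cong V
  (adjacent-⊆ λ { (here e≡) → here e≡ ; (there e∈) → e∈ }) (adjacent-⊆ there)

components-extend : ∀ {V X Y} → Within (suc V) X → Within V Y →
  (∀ {i j} → i < V → j < V → Walk X j i ⇔ Walk Y j i) →
  components (suc V) X ≡ components V Y + count (isLeader (suc V) X) [ V ]
components-extend {V} {X} {Y} wX wY same = begin
  count (isLeader (suc V) X) (upTo (suc V))
    ≡⟨ cong (count (isLeader (suc V) X)) (sym (upTo-∷ʳ V)) ⟩
  count (isLeader (suc V) X) (upTo V ++ [ V ])
    ≡⟨ count-++ (isLeader (suc V) X) (upTo V) [ V ] ⟩
  count (isLeader (suc V) X) (upTo V) + count (isLeader (suc V) X) [ V ]
    ≡⟨ cong (_+ _) (count-cong (upTo V) λ i∈ → let i<V = ∈-upTo⁻ i∈ in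
         isLeader-cong wX wY (m<n⇒m<1+n i<V) i<V λ j<i → same i<V (<-trans j<i i<V)) ⟩
  count (isLeader V Y) (upTo V) + count (isLeader (suc V) X) [ V ] ∎
  where open ≡-Reasoning

top-isolated : ∀ {V X} → Within (suc V) X → (∀ {j} → j < V → ¬ Walk X j V) →
  count (isLeader (suc V) X) [ V ] ≡ 1
top-isolated {V} {X} wX lonely with any (λ j → connected (suc V) X j V) (upTo V) in joined
... | false = refl
... | true with j , j∈ , c ← find (any⁻ _ (upTo V) (subst T (sym joined) _)) =
  ⊥-elim (lonely (∈-upTo⁻ j∈) (to (connected⇔walk wX (m<n⇒m<1+n (∈-upTo⁻ j∈))) c))

top-joined : ∀ {V X u} → Within (suc V) X → u < V → Walk X u V →
  count (isLeader (suc V) X) [ V ] ≡ 0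
top-joined {V} {X} {u} wX u<V w with any (λ j → connected (suc V) X j V) (upTo V) in joined
... | true = refl
... | false = ⊥-elim (subst T joined
  (any⁺ _ (lose (∈-upTo⁺ u<V) (from (connected⇔walk wX (m<n⇒m<1+n u<V)) w))))

components-isolated : ∀ {V A} → Within V A → components (suc V) A ≡ suc (components V A)
components-isolated {V} {A} w = begin
  components (suc V) A
    ≡⟨ components-extend (within-suc w) w (λ _ _ → mk⇔ id id) ⟩
  components V A + count (isLeader (suc V) A) [ V ]
    ≡⟨ cong (_+_ (components V A)) (top-isolated (within-suc w) lonely) ⟩
  components V A + 1
    ≡⟨ +-comm (components V A) 1 ⟩
  suc (components V A) ∎
  where
  open ≡-Reasoning
  lonely : ∀ {j} → j < V → ¬ Walk A j V
  lonely j<V walk with walk-end w walk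
  ... | inj₁ refl = <-irrefl refl j<V
  ... | inj₂ V<V = <-irrefl refl V<V

merge : ℕ → ℕ → ℕ → ℕ
merge v u x with x ≟ v
... | yes _ = u
... | no _  = x

mergeEdge : ℕ → ℕ → Edge → Edge
mergeEdge v u (a , b) = merge v u a , merge v u b

merge-self : ∀ v u → merge v u v ≡ u
merge-self v u with v ≟ v
... | yes _  = refl
... | no v≢v = ⊥-elim (v≢v refl)

merge-below : ∀ {v x} u → x < v → merge v u x ≡ x
merge-below {v} {x} u x<v with x ≟ v
... | yes refl = ⊥-elim (<-irrefl refl x<v)
... | no _     = refl

merge-< : ∀ {V u x} → u < V → x < suc V → merge V u x < V
merge-< {V} {u} {x} u<V (s≤s x≤V) with x ≟ V
... | yes _  = u<V
... | no x≢V = ≤∧≢⇒< x≤V x≢V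

merge-within : ∀ {V A} u → Within V A → map (mergeEdge V u) A ≡ A
merge-within u =
  map-id-local ∘ All.map λ (a<V , b<V) → cong₂ _,_ (merge-below u a<V) (merge-below u b<V)

module Contraction {V u B} (wB : Within (suc V) B) (u<V : u < V) where

  X Y : List Edge
  X = (u , V) ∷ B
  Y = map (mergeEdge V u) B

  wX : Within (suc V) X
  wX = (m<n⇒m<1+n u<V , n<1+n V) ∷ wB

  wY : Within V Y
  wY = All.map⁺ (All.map (Product.map (merge-< u<V) (merge-< u<V)) wB)

  project : ∀ {a b} → Adjacent X a b → Walk Y (merge V u a) (merge V u b)
  project (inj₁ (here refl)) =
    subst₂ (Walk Y) (sym (merge-below u u<V)) (sym (merge-self V u)) ε
  project (inj₂ (here refl)) =
    subst₂ (Walk Y) (sym (merge-self V u)) (sym (merge-below u u<V)) ε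
  project (inj₁ (there e∈B)) = return (inj₁ (∈-map⁺ (mergeEdge V u) e∈B))
  project (inj₂ (there e∈B)) = return (inj₂ (∈-map⁺ (mergeEdge V u) e∈B))

  unmerge : ∀ x → Walk X (merge V u x) x
  unmerge x with x ≟ V
  ... | yes refl = return (inj₁ (here refl))
  ... | no _     = ε

  lift : ∀ {a b} → Adjacent Y a b → Walk X a b
  lift (inj₁ ab∈Y) with (c , d) , cd∈B , refl ← ∈-map⁻ (mergeEdge V u) ab∈Y =
    unmerge c ◅◅ inj₁ (there cd∈B) ◅ reverse Sum.swap (unmerge d)
  lift (inj₂ ba∈Y) with (c , d) , cd∈B , refl ← ∈-map⁻ (mergeEdge V u) ba∈Y =
    unmerge d ◅◅ inj₂ (there cd∈B) ◅ reverse Sum.swap (unmerge c)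

  same-walks : ∀ {i j} → i < V → j < V → Walk X j i ⇔ Walk Y j i
  same-walks i<V j<V = mk⇔
    (subst₂ (Walk Y) (merge-below u j<V) (merge-below u i<V) ∘ kleisliStar (merge V u) project)
    (lift ⋆)

components-contract : ∀ {V u B} → Within (suc V) B → u < V →
  components (suc V) ((u , V) ∷ B) ≡ components V (map (mergeEdge V u) B)
components-contract {V} {u} {B} wB u<V = begin
  components (suc V) X
    ≡⟨ components-extend wX wY same-walks ⟩
  components V Y + count (isLeader (suc V) X) [ V ]
    ≡⟨ cong (_+_ (components V Y)) (top-joined wX u<V (return (inj₁ (here refl)))) ⟩
  components V Y + 0
    ≡⟨ +-identityʳ (components V Y) ⟩
  components V Y ∎
  where
  open ≡-Reasoning
  open Contraction wB u<V

components-pendant : ∀ {V A u} → Within V A → u < V →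
  components (suc V) ((u , V) ∷ A) ≡ components V A
components-pendant {V} {A} {u} w u<V =
  trans (components-contract (within-suc w) u<V) (cong (components V) (merge-within u w))

components-subdivide : ∀ {V A u v} → Within V A → u < V → v < V →
  components (suc V) ((u , V) ∷ (v , V) ∷ A) ≡ components V ((u , v) ∷ A)
components-subdivide {V} {A} {u} {v} w u<V v<V = begin
  components (suc V) ((u , V) ∷ (v , V) ∷ A)
    ≡⟨ components-contract ((m<n⇒m<1+n v<V , n<1+n V) ∷ within-suc w) u<V ⟩
  components V (mergeEdge V u (v , V) ∷ map (mergeEdge V u) A)
    ≡⟨ cong (components V)
         (cong₂ _∷_ (cong₂ _,_ (merge-below u v<V) (merge-self V u)) (merge-within u w)) ⟩
  components V ((v , u) ∷ A)
    ≡⟨ components-cong V adjacent-flip adjacent-flip ⟩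
  components V ((u , v) ∷ A) ∎
  where open ≡-Reasoning

-- Sums over subsets

sumℤ-++ : ∀ xs ys → sumℤ (xs ++ ys) ≡ sumℤ xs +ℤ sumℤ ys
sumℤ-++ []       ys = sym (ℤ.+-identityˡ (sumℤ ys))
sumℤ-++ (x ∷ xs) ys =
  trans (cong (x +ℤ_) (sumℤ-++ xs ys)) (sym (ℤ.+-assoc x (sumℤ xs) (sumℤ ys)))

module _ {X : Set} where

  sumℤ-map-* : ∀ c (g : X → ℤ) xs → sumℤ (map (λ a → c *ℤ g a) xs) ≡ c *ℤ sumℤ (map g xs)
  sumℤ-map-* c g []       = sym (ℤ.*-zeroʳ c)
  sumℤ-map-* c g (x ∷ xs) = trans (cong (c *ℤ g x +ℤ_) (sumℤ-map-* c g xs))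
    (sym (ℤ.*-distribˡ-+ c (g x) (sumℤ (map g xs))))

  subsetSum : (List X → ℤ) → List X → ℤ
  subsetSum g E = sumℤ (map g (subsets E))

  subsetSum-∷ : ∀ g x E → subsetSum g (x ∷ E) ≡ subsetSum (g ∘ (x ∷_)) E +ℤ subsetSum g E
  subsetSum-∷ g x E = begin
    sumℤ (map g (map (x ∷_) (subsets E) ++ subsets E))
      ≡⟨ cong sumℤ (map-++ g (map (x ∷_) (subsets E)) (subsets E)) ⟩
    sumℤ (map g (map (x ∷_) (subsets E)) ++ map g (subsets E))
      ≡⟨ sumℤ-++ (map g (map (x ∷_) (subsets E))) (map g (subsets E)) ⟩
    sumℤ (map g (map (x ∷_) (subsets E))) +ℤ subsetSum g E
      ≡⟨ cong (λ xs → sumℤ xs +ℤ subsetSum g E) (sym (map-∘ (subsets E))) ⟩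
    subsetSum (g ∘ (x ∷_)) E +ℤ subsetSum g E ∎
    where open ≡-Reasoning

  subsetSum-∷∷ : ∀ g x y E → subsetSum g (x ∷ y ∷ E) ≡
    (subsetSum (g ∘ (x ∷_) ∘ (y ∷_)) E +ℤ subsetSum (g ∘ (x ∷_)) E) +ℤ
    (subsetSum (g ∘ (y ∷_)) E +ℤ subsetSum g E)
  subsetSum-∷∷ g x y E = trans (subsetSum-∷ g x (y ∷ E))
    (cong₂ _+ℤ_ (subsetSum-∷ (g ∘ (x ∷_)) y E) (subsetSum-∷ g y E))

  subsetSum-cong : ∀ {g h} E → (∀ {A} → A ⊆ E → g A ≡ h A) → subsetSum g E ≡ subsetSum h E
  subsetSum-cong []      g≡h = cong (_+ℤ 0ℤ) (g≡h [])
  subsetSum-cong {g} {h} (x ∷ E) g≡h = begin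
    subsetSum g (x ∷ E)                          ≡⟨ subsetSum-∷ g x E ⟩
    subsetSum (g ∘ (x ∷_)) E +ℤ subsetSum g E
      ≡⟨ cong₂ _+ℤ_ (subsetSum-cong E (λ A⊆E → g≡h (refl ∷ A⊆E)))
                    (subsetSum-cong E (λ A⊆E → g≡h (x ∷ʳ A⊆E))) ⟩
    subsetSum (h ∘ (x ∷_)) E +ℤ subsetSum h E    ≡⟨ sym (subsetSum-∷ h x E) ⟩
    subsetSum h (x ∷ E) ∎
    where open ≡-Reasoning

  subsetSum-↭ : ∀ {E F} g → (∀ {A B} → A ↭ B → g A ≡ g B) → E ↭ F →
    subsetSum g E ≡ subsetSum g F
  subsetSum-↭ g inv ↭.refl = refl
  subsetSum-↭ {x ∷ E} {x ∷ F} g inv (↭.prep x E↭F) = begin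
    subsetSum g (x ∷ E)                         ≡⟨ subsetSum-∷ g x E ⟩
    subsetSum (g ∘ (x ∷_)) E +ℤ subsetSum g E
      ≡⟨ cong₂ _+ℤ_ (subsetSum-↭ (g ∘ (x ∷_)) (inv ∘ ↭.prep x) E↭F)
                    (subsetSum-↭ g inv E↭F) ⟩
    subsetSum (g ∘ (x ∷_)) F +ℤ subsetSum g F   ≡⟨ sym (subsetSum-∷ g x F) ⟩
    subsetSum g (x ∷ F) ∎
    where open ≡-Reasoning
  subsetSum-↭ {x ∷ y ∷ E} {y ∷ x ∷ F} g inv (↭.swap x y E↭F) = begin
    subsetSum g (x ∷ y ∷ E)
      ≡⟨ subsetSum-∷∷ g x y E ⟩
    (Σxy E +ℤ Σx E) +ℤ (Σy E +ℤ subsetSum g E)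
      ≡⟨ interchange (Σxy E) (Σx E) (Σy E) (subsetSum g E) ⟩
    (Σxy E +ℤ Σy E) +ℤ (Σx E +ℤ subsetSum g E)
      ≡⟨ cong₂ _+ℤ_ (cong₂ _+ℤ_ xy≡yx (subsetSum-↭ (g ∘ (y ∷_)) (inv ∘ ↭.prep y) E↭F))
                    (cong₂ _+ℤ_ (subsetSum-↭ (g ∘ (x ∷_)) (inv ∘ ↭.prep x) E↭F)
                                (subsetSum-↭ g inv E↭F)) ⟩
    (Σyx F +ℤ Σy F) +ℤ (Σx F +ℤ subsetSum g F)
      ≡⟨ sym (subsetSum-∷∷ g y x F) ⟩
    subsetSum g (y ∷ x ∷ F) ∎
    where
    open ≡-Reasoning
    Σx Σy Σxy Σyx : List X → ℤ
    Σx  = subsetSum (g ∘ (x ∷_))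
    Σy  = subsetSum (g ∘ (y ∷_))
    Σxy = subsetSum (g ∘ (x ∷_) ∘ (y ∷_))
    Σyx = subsetSum (g ∘ (y ∷_) ∘ (x ∷_))
    xy≡yx : Σxy E ≡ Σyx F
    xy≡yx = trans (subsetSum-↭ (g ∘ (x ∷_) ∘ (y ∷_)) (inv ∘ ↭.prep x ∘ ↭.prep y) E↭F)
                  (subsetSum-cong F λ _ → inv (↭.swap x y ↭.refl))
  subsetSum-↭ g inv (↭.trans E↭G G↭F) = trans (subsetSum-↭ g inv E↭G) (subsetSum-↭ g inv G↭F)

-- The Tutte summand of a connected graph

-- For a connected graph on V vertices, the exponents r(E) − r(A) and |A| − r(A) of the
-- Tutte summand of A are c − 1 and l + c − V, where A has l edges and c components.
term : ℤ → ℤ → ℕ → ℕ → ℕ → ℤ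
term x y V c l = (x - 1ℤ) ^ℤ (c ∸ 1) *ℤ (y - 1ℤ) ^ℤ (l + c ∸ V)

weight : ℤ → ℤ → ℕ → List Edge → ℤ
weight x y V A = term x y V (components V A) (length A)

corank≡ : ∀ {V c} → c ≤ V → (V ∸ 1) ∸ (V ∸ c) ≡ c ∸ 1
corank≡ {V} {c} c≤V = begin
  V ∸ 1 ∸ (V ∸ c)    ≡⟨ ∸-+-assoc V 1 (V ∸ c) ⟩
  V ∸ (1 + (V ∸ c))  ≡⟨ cong (V ∸_) (+-comm 1 (V ∸ c)) ⟩
  V ∸ (V ∸ c + 1)    ≡⟨ sym (∸-+-assoc V (V ∸ c) 1) ⟩
  V ∸ (V ∸ c) ∸ 1    ≡⟨ cong (_∸ 1) (m∸[m∸n]≡n c≤V) ⟩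
  c ∸ 1 ∎
  where open ≡-Reasoning

nullity≡ : ∀ {V c} l → c ≤ V → l ∸ (V ∸ c) ≡ l + c ∸ V
nullity≡ {V} {c} l c≤V = begin
  l ∸ (V ∸ c)            ≡⟨ cong (_∸ (V ∸ c)) (sym (m+n∸n≡m l c)) ⟩
  l + c ∸ c ∸ (V ∸ c)    ≡⟨ ∸-+-assoc (l + c) c (V ∸ c) ⟩
  l + c ∸ (c + (V ∸ c))  ≡⟨ cong (l + c ∸_) (m+[n∸m]≡n c≤V) ⟩
  l + c ∸ V ∎
  where open ≡-Reasoning

tutte-connected : ∀ x y V E → components V E ≡ 1 →
  tutte (graph V E) x y ≡ subsetSum (weight x y V) E
tutte-connected x y V E connected = cong sumℤ (map-cong summand (subsets E))
  where
  summand : ∀ A → (x - + 1) ^ℤ (rank V E ∸ rank V A) *ℤ (y - + 1) ^ℤ (length A ∸ rank V A)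
                ≡ weight x y V A
  summand A rewrite connected = cong₂ (λ a b → (x - 1ℤ) ^ℤ a *ℤ (y - 1ℤ) ^ℤ b)
    (corank≡ (components≤ V A)) (nullity≡ (length A) (components≤ V A))

term-isolated : ∀ x y V c l → 1 ≤ c → term x y (suc V) (suc c) l ≡ (x - 1ℤ) *ℤ term x y V c l
term-isolated x y V (suc c) l _ rewrite +-suc l (suc c) =
  ℤ.*-assoc (x - 1ℤ) ((x - 1ℤ) ^ℤ c) ((y - 1ℤ) ^ℤ (l + suc c ∸ V))

term-parallel : ∀ x y V c l → V ≤ l + c → term x y V c (suc l) ≡ (y - 1ℤ) *ℤ term x y V c l
term-parallel x y V c l V≤l+c rewrite +-∸-assoc 1 V≤l+c =
  x∙yz≈y∙xz ((x - 1ℤ) ^ℤ (c ∸ 1)) (y - 1ℤ) ((y - 1ℤ) ^ℤ (l + c ∸ V))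

module _ (x y : ℤ) where

  weight-isolated : ∀ {V A} → Within (suc V) A →
    weight x y (2 + V) A ≡ (x - 1ℤ) *ℤ weight x y (suc V) A
  weight-isolated {V} {A} w =
    trans (cong (λ c → term x y (2 + V) c (length A)) (components-isolated w))
          (term-isolated x y (suc V) (components (suc V) A) (length A) (components-pos V A))

  weight-pendant : ∀ {V A u} → Within V A → u < V →
    weight x y (suc V) ((u , V) ∷ A) ≡ weight x y V A
  weight-pendant {V} {A} w u<V =
    cong (λ c → term x y (suc V) c (suc (length A))) (components-pendant w u<V)

  weight-subdivide : ∀ {V A u v} → Within V A → u < V → v < V →
    weight x y (suc V) ((u , V) ∷ (v , V) ∷ A) ≡ weight x y V ((u , v) ∷ A)
  weight-subdivide {V} {A} w u<V v<V =
    cong (λ c → term x y (suc V) c (2 + length A)) (components-subdivide w u<V v<V)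

  weight-parallel : ∀ {V A} e → V ≤ length (e ∷ A) + components V (e ∷ A) →
    weight x y V (e ∷ e ∷ A) ≡ (y - 1ℤ) *ℤ weight x y V (e ∷ A)
  weight-parallel {V} {A} e bound =
    trans (cong (λ c → term x y V c (2 + length A)) (components-dedup V e A))
    (term-parallel x y V (components V (e ∷ A)) (suc (length A)) bound)

weight-↭ : ∀ x y V {A B} → A ↭ B → weight x y V A ≡ weight x y V B
weight-↭ x y V A↭B = cong₂ (term x y V)
  (components-cong V (adjacent-⊆ (∈-resp-↭ A↭B)) (adjacent-⊆ (∈-resp-↭ (↭.↭-sym A↭B))))
  (↭-length A↭B)

-- Broken wheels

spoke path : ℕ → Edge
spoke k = 0 , suc k
path  k = suc k , 2 + k

-- wheel k lists the edges of BW_(k+1), newest vertex first.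
wheel : ℕ → List Edge
rim : ℕ → List Edge
wheel k     = spoke k ∷ rim k
rim zero    = spoke 0 ∷ []
rim (suc k) = path k ∷ wheel k

wheel-within : ∀ k → Within (2 + k) (wheel k)
wheel-within zero    = (s≤s z≤n , ≤-refl) ∷ (s≤s z≤n , ≤-refl) ∷ []
wheel-within (suc k) =
  (s≤s z≤n , ≤-refl) ∷ (m<n⇒m<1+n ≤-refl , ≤-refl) ∷ within-suc (wheel-within k)

⊆wheel-within : ∀ {k A} → A ⊆ wheel k → Within (2 + k) A
⊆wheel-within {k} A⊆ = All-resp-⊆ A⊆ (wheel-within k)

wheel-connected : ∀ k → components (2 + k) (wheel k) ≡ 1
wheel-connected zero    = refl
wheel-connected (suc k) = begin
  components (3 + k) (spoke (suc k) ∷ path k ∷ wheel k)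
    ≡⟨ components-subdivide (wheel-within k) (s≤s z≤n) ≤-refl ⟩
  components (2 + k) (spoke k ∷ spoke k ∷ rim k)
    ≡⟨ components-dedup (2 + k) (spoke k) (rim k) ⟩
  components (2 + k) (wheel k)
    ≡⟨ wheel-connected k ⟩
  1 ∎
  where open ≡-Reasoning

-- r(A) ≤ |A|: the nullity exponent in term is not truncated.
wheel-rank : ∀ k {A} → A ⊆ wheel k → 2 + k ≤ length A + components (2 + k) A
spoke-rank : ∀ k {A} → A ⊆ wheel k →
  2 + k ≤ length (spoke k ∷ A) + components (2 + k) (spoke k ∷ A)

wheel-rank zero (refl ∷ refl ∷ []) = s≤s (s≤s z≤n)
wheel-rank zero (refl ∷ (_ ∷ʳ [])) = s≤s (s≤s z≤n)
wheel-rank zero (_ ∷ʳ (refl ∷ [])) = s≤s (s≤s z≤n)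
wheel-rank zero (_ ∷ʳ (_ ∷ʳ []))   = s≤s (s≤s z≤n)
wheel-rank (suc k) {_ ∷ _ ∷ A} (refl ∷ refl ∷ A⊆) =
  subst (λ c → 3 + k ≤ 2 + length A + c)
    (sym (components-subdivide (⊆wheel-within A⊆) (s≤s z≤n) ≤-refl)) (s≤s (spoke-rank k A⊆))
wheel-rank (suc k) {_ ∷ A} (refl ∷ (_ ∷ʳ A⊆)) =
  subst (λ c → 3 + k ≤ 1 + length A + c)
    (sym (components-pendant (⊆wheel-within A⊆) (s≤s z≤n))) (s≤s (wheel-rank k A⊆))
wheel-rank (suc k) {_ ∷ A} (_ ∷ʳ (refl ∷ A⊆)) =
  subst (λ c → 3 + k ≤ 1 + length A + c)
    (sym (components-pendant (⊆wheel-within A⊆) ≤-refl)) (s≤s (wheel-rank k A⊆))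
wheel-rank (suc k) {A} (_ ∷ʳ (_ ∷ʳ A⊆)) =
  subst (λ c → 3 + k ≤ length A + c) (sym (components-isolated (⊆wheel-within A⊆)))
    (subst (3 + k ≤_) (sym (+-suc (length A) (components (2 + k) A))) (s≤s (wheel-rank k A⊆)))

spoke-rank k {_ ∷ A} (refl ∷ A⊆) =
  subst (λ c → 2 + k ≤ 2 + length A + c) (sym (components-dedup (2 + k) (spoke k) A))
    (≤-trans (wheel-rank k (refl ∷ A⊆)) (n≤1+n _))
spoke-rank k (_ ∷ʳ A⊆) = wheel-rank k (refl ∷ A⊆)

heads↭lasts : ∀ {X : Set} (a b : X) xs ys → a ∷ b ∷ xs ++ ys ↭ (xs ++ [ a ]) ++ (ys ++ [ b ])
heads↭lasts a b xs ys = begin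
  a ∷ b ∷ xs ++ ys                ↭⟨ ↭.prep a (↭.↭-sym (shift b xs ys)) ⟩
  a ∷ xs ++ b ∷ ys                ↭⟨ ↭.prep a (++⁺ˡ xs (∷↭∷ʳ b ys)) ⟩
  a ∷ xs ++ ys ++ [ b ]           ↭⟨ ↭.↭-sym (shift a xs (ys ++ [ b ])) ⟩
  xs ++ a ∷ ys ++ [ b ]           ≡⟨ sym (++-assoc xs [ a ] (ys ++ [ b ])) ⟩
  (xs ++ [ a ]) ++ (ys ++ [ b ]) ∎
  where open ↭.PermutationReasoning

wheel↭brokenWheel : ∀ k → wheel k ↭ E (brokenWheel (suc k))
wheel↭brokenWheel zero    = ↭.refl
wheel↭brokenWheel (suc k) = begin
  s ∷ p ∷ wheel k
    ↭⟨ ↭.prep s (↭.prep p (wheel↭brokenWheel k)) ⟩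
  s ∷ p ∷ e ∷ e ∷ spokes k ++ paths k
    ↭⟨ shifts (s ∷ p ∷ []) (e ∷ e ∷ []) ⟩
  e ∷ e ∷ s ∷ p ∷ spokes k ++ paths k
    ↭⟨ ↭.prep e (↭.prep e (heads↭lasts s p (spokes k) (paths k))) ⟩
  e ∷ e ∷ (spokes k ++ [ s ]) ++ (paths k ++ [ p ])
    ≡⟨ cong₂ (λ S P → e ∷ e ∷ S ++ P) spokes-suc paths-suc ⟩
  E (brokenWheel (2 + k)) ∎
  where
  open ↭.PermutationReasoning
  e s p : Edge
  e = spoke 0
  s = spoke (suc k)
  p = path k
  spoke′ path′ : ℕ → Edge
  spoke′ j = 0 , j + 2
  path′  j = j + 1 , j + 2
  spokes paths : ℕ → List Edge
  spokes = applyUpTo spoke′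
  paths  = applyUpTo path′
  spokes-suc : spokes k ++ [ s ] ≡ spokes (suc k)
  spokes-suc = trans (cong (λ n → spokes k ++ [ 0 , n ]) (+-comm 2 k)) (applyUpTo-∷ʳ spoke′ k)
  paths-suc : paths k ++ [ p ] ≡ paths (suc k)
  paths-suc =
    trans (cong₂ (λ m n → paths k ++ [ m , n ]) (+-comm 1 k) (+-comm 2 k)) (applyUpTo-∷ʳ path′ k)

private
  t+[x-1]t≡xt : ∀ x t → t +ℤ (x - 1ℤ) *ℤ t ≡ x *ℤ t
  t+[x-1]t≡xt = solve-∀

  [y-1]t+t≡yt : ∀ y t → (y - 1ℤ) *ℤ t +ℤ t ≡ y *ℤ t
  [y-1]t+t≡yt = solve-∀

module WheelSums (x y : ℤ) where

  w : ℕ → List Edge → ℤ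
  w k = weight x y (2 + k)

  wheelSum spokeSum rimSum : ℕ → ℤ
  wheelSum k = subsetSum (w k) (wheel k)
  spokeSum k = subsetSum (w k ∘ (spoke k ∷_)) (rim k)
  rimSum   k = subsetSum (w k) (rim k)

  wheelSum-split : ∀ k → wheelSum k ≡ spokeSum k +ℤ rimSum k
  wheelSum-split k = subsetSum-∷ (w k) (spoke k) (rim k)

  rimSum-suc : ∀ k → rimSum (suc k) ≡ x *ℤ wheelSum k
  rimSum-suc k = begin
    subsetSum (w (suc k)) (path k ∷ wheel k)
      ≡⟨ subsetSum-∷ (w (suc k)) (path k) (wheel k) ⟩
    subsetSum (w (suc k) ∘ (path k ∷_)) (wheel k) +ℤ subsetSum (w (suc k)) (wheel k)
      ≡⟨ cong₂ _+ℤ_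
           (subsetSum-cong (wheel k) λ A⊆ → weight-pendant x y (⊆wheel-within A⊆) ≤-refl)
           (subsetSum-cong (wheel k) λ A⊆ → weight-isolated x y (⊆wheel-within A⊆)) ⟩
    wheelSum k +ℤ subsetSum (λ A → (x - 1ℤ) *ℤ w k A) (wheel k)
      ≡⟨ cong (wheelSum k +ℤ_) (sumℤ-map-* (x - 1ℤ) (w k) (subsets (wheel k))) ⟩
    wheelSum k +ℤ (x - 1ℤ) *ℤ wheelSum k
      ≡⟨ t+[x-1]t≡xt x (wheelSum k) ⟩
    x *ℤ wheelSum k ∎
    where open ≡-Reasoning

  doubled-spoke : ∀ k → subsetSum (w k ∘ (spoke k ∷_)) (wheel k) ≡ y *ℤ spokeSum k
  doubled-spoke k = begin
    subsetSum (w k ∘ (spoke k ∷_)) (wheel k)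
      ≡⟨ subsetSum-∷ (w k ∘ (spoke k ∷_)) (spoke k) (rim k) ⟩
    subsetSum (w k ∘ (spoke k ∷_) ∘ (spoke k ∷_)) (rim k) +ℤ spokeSum k
      ≡⟨ cong (_+ℤ spokeSum k) (subsetSum-cong (rim k) λ B⊆ →
           weight-parallel x y (spoke k) (wheel-rank k (refl ∷ B⊆))) ⟩
    subsetSum (λ B → (y - 1ℤ) *ℤ w k (spoke k ∷ B)) (rim k) +ℤ spokeSum k
      ≡⟨ cong (_+ℤ spokeSum k) (sumℤ-map-* (y - 1ℤ) (w k ∘ (spoke k ∷_)) (subsets (rim k))) ⟩
    (y - 1ℤ) *ℤ spokeSum k +ℤ spokeSum k
      ≡⟨ [y-1]t+t≡yt y (spokeSum k) ⟩
    y *ℤ spokeSum k ∎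
    where open ≡-Reasoning

  spokeSum-suc : ∀ k → spokeSum (suc k) ≡ y *ℤ spokeSum k +ℤ wheelSum k
  spokeSum-suc k = begin
    subsetSum (w (suc k) ∘ (spoke (suc k) ∷_)) (path k ∷ wheel k)
      ≡⟨ subsetSum-∷ (w (suc k) ∘ (spoke (suc k) ∷_)) (path k) (wheel k) ⟩
    subsetSum (w (suc k) ∘ (spoke (suc k) ∷_) ∘ (path k ∷_)) (wheel k) +ℤ
    subsetSum (w (suc k) ∘ (spoke (suc k) ∷_)) (wheel k)
      ≡⟨ cong₂ _+ℤ_
           (subsetSum-cong (wheel k) λ A⊆ →
              weight-subdivide x y (⊆wheel-within A⊆) (s≤s z≤n) ≤-refl)
           (subsetSum-cong (wheel k) λ A⊆ → weight-pendant x y (⊆wheel-within A⊆) (s≤s z≤n)) ⟩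
    subsetSum (w k ∘ (spoke k ∷_)) (wheel k) +ℤ wheelSum k
      ≡⟨ cong (_+ℤ wheelSum k) (doubled-spoke k) ⟩
    y *ℤ spokeSum k +ℤ wheelSum k ∎
    where open ≡-Reasoning

open WheelSums

tutte-brokenWheel : ∀ x y k → tutte (brokenWheel (suc k)) x y ≡ wheelSum x y k
tutte-brokenWheel x y k = begin
  tutte (brokenWheel (suc k)) x y            ≡⟨ tutte-connected x y (2 + k) E′ E′-connected ⟩
  subsetSum (weight x y (2 + k)) E′          ≡⟨ sym (subsetSum-↭ (weight x y (2 + k)) (weight-↭ x y (2 + k)) W↭E) ⟩
  wheelSum x y k ∎
  where
  open ≡-Reasoning
  E′ : List Edge
  E′ = E (brokenWheel (suc k))
  W↭E : wheel k ↭ E′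
  W↭E = wheel↭brokenWheel k
  E′-connected : components (2 + k) E′ ≡ 1
  E′-connected = trans (components-cong (2 + k)
    (adjacent-⊆ (∈-resp-↭ (↭.↭-sym W↭E))) (adjacent-⊆ (∈-resp-↭ W↭E))) (wheel-connected k)

wheelSum₁₀-doubles : ∀ k → wheelSum 1ℤ 0ℤ (suc k) ≡ wheelSum 1ℤ 0ℤ k +ℤ wheelSum 1ℤ 0ℤ k
wheelSum₁₀-doubles k = begin
  wheelSum 1ℤ 0ℤ (suc k)                          ≡⟨ wheelSum-split 1ℤ 0ℤ (suc k) ⟩
  spokeSum 1ℤ 0ℤ (suc k) +ℤ rimSum 1ℤ 0ℤ (suc k)  ≡⟨ cong₂ _+ℤ_ (spokeSum-suc 1ℤ 0ℤ k) (rimSum-suc 1ℤ 0ℤ k) ⟩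
  0ℤ *ℤ spokeSum 1ℤ 0ℤ k +ℤ t +ℤ 1ℤ *ℤ t         ≡⟨ cong₂ _+ℤ_ (ℤ.+-identityˡ t) (ℤ.*-identityˡ t) ⟩
  t +ℤ t ∎
  where
  open ≡-Reasoning
  t : ℤ
  t = wheelSum 1ℤ 0ℤ k

rimSum₀₁≡0 : ∀ k → rimSum 0ℤ 1ℤ k ≡ 0ℤ
rimSum₀₁≡0 zero    = refl
rimSum₀₁≡0 (suc k) = rimSum-suc 0ℤ 1ℤ k

wheelSum₀₁-doubles : ∀ k → wheelSum 0ℤ 1ℤ (suc k) ≡ wheelSum 0ℤ 1ℤ k +ℤ wheelSum 0ℤ 1ℤ k
wheelSum₀₁-doubles k = begin
  wheelSum 0ℤ 1ℤ (suc k)                          ≡⟨ wheelSum-split 0ℤ 1ℤ (suc k) ⟩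
  spokeSum 0ℤ 1ℤ (suc k) +ℤ rimSum 0ℤ 1ℤ (suc k)  ≡⟨ cong₂ _+ℤ_ (spokeSum-suc 0ℤ 1ℤ k) (rimSum-suc 0ℤ 1ℤ k) ⟩
  1ℤ *ℤ p +ℤ t +ℤ 0ℤ                              ≡⟨ ℤ.+-identityʳ (1ℤ *ℤ p +ℤ t) ⟩
  1ℤ *ℤ p +ℤ t                                    ≡⟨ cong (_+ℤ t) (trans (ℤ.*-identityˡ p) p≡t) ⟩
  t +ℤ t ∎
  where
  open ≡-Reasoning
  t p : ℤ
  t = wheelSum 0ℤ 1ℤ k
  p = spokeSum 0ℤ 1ℤ k
  p≡t : p ≡ t
  p≡t = sym (begin
    t                    ≡⟨ wheelSum-split 0ℤ 1ℤ k ⟩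
    p +ℤ rimSum 0ℤ 1ℤ k  ≡⟨ cong (p +ℤ_) (rimSum₀₁≡0 k) ⟩
    p +ℤ 0ℤ              ≡⟨ ℤ.+-identityʳ p ⟩
    p ∎)

doubling⇒power : ∀ (f : ℕ → ℤ) → f 0 ≡ 1ℤ → (∀ k → f (suc k) ≡ f k +ℤ f k) →
  ∀ k → f k ≡ + (2 ^ k)
doubling⇒power f f0 step zero    = f0
doubling⇒power f f0 step (suc k) = begin
  f (suc k)          ≡⟨ step k ⟩
  f k +ℤ f k         ≡⟨ cong₂ _+ℤ_ (doubling⇒power f f0 step k) (doubling⇒power f f0 step k) ⟩
  + (2 ^ k + 2 ^ k)  ≡⟨ cong (λ n → + (2 ^ k + n)) (sym (+-identityʳ (2 ^ k))) ⟩
  + (2 ^ suc k) ∎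
  where open ≡-Reasoning

proposition5 : (n : ℕ) → n ≥ 1 →
    (tutte (brokenWheel n) (+ 1) (+ 0) ≡ + (2 ^ (n ∸ 1)))
    × (tutte (brokenWheel n) (+ 0) (+ 1) ≡ + (2 ^ (n ∸ 1)))
proposition5 (suc k) _ =
  trans (tutte-brokenWheel 1ℤ 0ℤ k) (doubling⇒power (wheelSum 1ℤ 0ℤ) refl wheelSum₁₀-doubles k) ,
  trans (tutte-brokenWheel 0ℤ 1ℤ k) (doubling⇒power (wheelSum 0ℤ 1ℤ) refl wheelSum₀₁-doubles k)
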